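{- Let $\vec{D}$ be a directed acyclic graph with vertex set $[n]$. Then $$\mathcal{E}^{\mathrm{tor}}([\vec{D}])=\bigsqcup_{[w]\in \mathcal{L}^{\mathrm{tor}}([\vec{D}])}\mathcal{E}^{\mathrm{tor}}([w]),$$ a disjoint union over all cyclic permutations $[w]$ that torically extend $[\vec{D}]$.
   Context: Let $\mathbb{P}'$ be the set of nonzero integers with the total order $-1\prec 1\prec -2\prec 2\prec -3\prec 3\prec\cdots$. For a DAG $\vec{D}$ on vertex set $[n]$, an enriched $\vec{D}$-partition is a function $f:[n]\to\mathbb{P}'$ such that for every arc $i\to j$: (a) $f(i)\preceq f(j)$; (b) $f(i)=f(j)>0$ implies $i<j$; (c) $f(i)=f(j)<0$ implies $i>j$ (usual integer order). $\mathcal{E}(\vec{D})$ is the set of these. A permutation $w=w_1\cdots w_n$ of $[n]$ is identified with the DAG with arcs $w_i\to w_j$ for $i<j$, and $w$ linearly extends $\vec{D}$ if this DAG contains $\vec{D}$. If a vertex $i_0$ is a source or a sink of a DAG, a flip at $i_0$ reverses all arcs incident to $i_0$; two DAGs are equivalent if one is obtained from the other by a sequence of flips, and the toric DAG $[\vec{D}]$ is the equivalence class of $\vec{D}$. For a permutation $w$, the cyclic permutation $[w]$ is the set of rotations $w_iw_{i+1}\cdots w_nw_1\cdots w_{i-1}$ of $w$; the toric DAG of $w$ consists exactly of the DAGs of the rotations of $w$. A cyclic permutation $[w]$ torically extends $[\vec{D}]$ if some rotation $w'\in[w]$ linearly extends some $\vec{D}'\in[\vec{D}]$; $\mathcal{L}^{\mathrm{tor}}([\vec{D}])$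 is the set of such cyclic permutations. An enriched toric $[\vec{D}]$-partition is a function $f:[n]\to\mathbb{P}'$ that is an enriched $\vec{D}'$-partition for at least one $\vec{D}'\in[\vec{D}]$; $\mathcal{E}^{\mathrm{tor}}([\vec{D}])=\bigcup_{\vec{D}'\in[\vec{D}]}\mathcal{E}(\vec{D}')$. In particular $\mathcal{E}^{\mathrm{tor}}([w])=\bigcup_{w'\in[w]}\mathcal{E}(w')$. -}

module Defs where

open import Data.Nat using (ℕ; _≤_; _<_)
open import Data.Fin using (Fin; _≟_) renaming (_<_ to _<ᶠ_)
open import Data.Bool using (Bool; true; false; if_then_else_; _∨_)
open import Data.List using (List; allFin; _∷_; _++_; drop; take)
open import Data.List.Relation.Binary.Permutation.Propositional using (_↭_)
open import Data.Product using (Σ; ∃; _×_; _,_)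
open import Data.Sum using (_⊎_)
open import Data.Empty using (⊥)
open import Data.Unit using (⊤)
open import Relation.Nullary using (¬_)
open import Relation.Nullary.Decidable using (⌊_⌋)
open import Relation.Binary.PropositionalEquality using (_≡_)
open import Relation.Binary.Construct.Closure.Transitive using (TransClosure)
open import Relation.Binary.Construct.Closure.ReflexiveTransitive using (Star)

-- The totally ordered set P' of nonzero integers
--   -1 ≺ 1 ≺ -2 ≺ 2 ≺ -3 ≺ 3 ≺ ⋯
-- neg k stands for the integer -(k+1), pos k for the integer k+1.

data P′ : Set where
  neg : ℕ → P′
  pos : ℕ → P′

infix 4 _⪯_
_⪯_ : P′ → P′ → Set
neg a ⪯ neg b = a ≤ b
neg a ⪯ pos b = a ≤ b
pos a ⪯ neg b = a < b
pos a ⪯ pos b = a ≤ b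

IsPositive : P′ → Set
IsPositive (pos _) = ⊤
IsPositive (neg _) = ⊥

IsNegative : P′ → Set
IsNegative (neg _) = ⊤
IsNegative (pos _) = ⊥

Digraph : ℕ → Set
Digraph n = Fin n → Fin n → Bool

Arc : ∀ {n} → Digraph n → Fin n → Fin n → Set
Arc D i j = D i j ≡ true

Acyclic : ∀ {n} → Digraph n → Set
Acyclic {n} D = (i : Fin n) → ¬ TransClosure (Arc D) i i

IsSource : ∀ {n} → Digraph n → Fin n → Set
IsSource {n} D i₀ = (j : Fin n) → D j i₀ ≡ false

IsSink : ∀ {n} → Digraph n → Fin n → Set
IsSink {n} D i₀ = (j : Fin n) → D i₀ j ≡ false

flipAt : ∀ {n} → Digraph n → Fin n → Digraph n
flipAt D i₀ a b = if ⌊ a ≟ i₀ ⌋ ∨ ⌊ b ≟ i₀ ⌋ then D b a else D a b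

FlipStep : ∀ {n} → Digraph n → Digraph n → Set
FlipStep {n} D D′ =
  Σ (Fin n) λ i₀ → (IsSource D i₀ ⊎ IsSink D i₀)
                 × ((a b : Fin n) → D′ a b ≡ flipAt D i₀ a b)

InToric : ∀ {n} → Digraph n → Digraph n → Set
InToric D D′ = Star FlipStep D D′

IsEnriched : ∀ {n} → (Fin n → Fin n → Set) → (Fin n → P′) → Set
IsEnriched {n} R f =
  (i j : Fin n) → R i j →
    (f i ⪯ f j)
  × (f i ≡ f j → IsPositive (f i) → i <ᶠ j)
  × (f i ≡ f j → IsNegative (f i) → j <ᶠ i)

Enriched : ∀ {n} → Digraph n → (Fin n → P′) → Set
Enriched D f = IsEnriched (Arc D) f

IsPerm : ∀ n → List (Fin n) → Set
IsPerm n w = w ↭ allFin n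

-- the DAG of a word: arc a → b iff a occurs before b in w
Before : ∀ {n} → List (Fin n) → Fin n → Fin n → Set
Before {n} w a b =
  Σ (List (Fin n)) λ xs → Σ (List (Fin n)) λ ys → Σ (List (Fin n)) λ zs →
    w ≡ xs ++ (a ∷ ys ++ (b ∷ zs))

LinExt : ∀ {n} → List (Fin n) → Digraph n → Set
LinExt {n} w D = (a b : Fin n) → Arc D a b → Before w a b

IsRotation : ∀ {n} → List (Fin n) → List (Fin n) → Set
IsRotation w w′ = ∃ λ k → w′ ≡ drop k w ++ take k w

EnrichedW : ∀ {n} → List (Fin n) → (Fin n → P′) → Set
EnrichedW w f = IsEnriched (Before w) f

EnrichedTor : ∀ {n} → Digraph n → (Fin n → P′) → Set
EnrichedTor {n} D f = Σ (Digraph n) λ D′ → InToric D D′ × Enriched D′ f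

EnrichedTorW : ∀ {n} → List (Fin n) → (Fin n → P′) → Set
EnrichedTorW {n} w f = Σ (List (Fin n)) λ w′ → IsRotation w w′ × EnrichedW w′ f

TorExt : ∀ {n} → List (Fin n) → Digraph n → Set
TorExt {n} w D =
  Σ (List (Fin n)) λ w′ → Σ (Digraph n) λ D′ →
    IsRotation w w′ × InToric D D′ × LinExt w′ D′

{-# OPTIONS --safe #-}
module Submission where

-- A map f : [n] → P′ determines a strict total order ◁ on [n]: compare
-- values, and break ties by the usual order on [n] when the common value
-- is positive and by the reverse order when it is negative.  The
-- condition an enriched partition imposes on an arc i → j is exactly
-- i ◁ j, so f ∈ 𝓔(w) iff w lists [n] in ◁-increasing order.  Hence f
-- lies in 𝓔(w) for exactly one permutation w, which gives
-- disjointness, and if f ∈ 𝓔(D′) then this w linearly extends D′.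
-- Conversely, the first letter of a linear extension is a source, and
-- moving it to the end is a flip at that source; so every rotation of a
-- linear extension of D′ linearly extends some member of [D′].

open import Defs
open import Data.Nat using (ℕ)
open import Data.Fin using (Fin)
open import Data.List using (List)
open import Data.Product using (Σ; _×_)
open import Function.Bundles using (_⇔_; mk⇔)

open import Data.Nat.Properties as ℕ using (≤-<-connex; <-≤-connex)
import Data.Fin as Fin
import Data.Fin.Properties as Fin
open import Data.Bool.Properties using (¬-not)
open import Data.List using ([]; _∷_; _++_; [_]; allFin; take; drop; length)
open import Data.List.Properties using (++-assoc; ++-identityʳ; ∷-injective; take++drop≡id)
import Data.List.Relation.Unary.All as All
open import Data.List.Relation.Unary.All.Properties using (++⁻ʳ)
open import Data.List.Relation.Unary.AllPairs as AllPairs using (AllPairs; []; _∷_)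
open import Data.List.Relation.Unary.Any using (here; there)
open import Data.List.Membership.Propositional using (_∈_)
open import Data.List.Membership.Propositional.Properties using (∈-∃++; ∈-allFin; ∈-++⁺ʳ)
open import Data.List.Relation.Unary.Unique.Propositional using (Unique)
open import Data.List.Relation.Unary.Unique.Propositional.Properties using (allFin⁺)
open import Data.List.Relation.Binary.Permutation.Propositional using (↭-sym; ↭-trans; ↭⇒↭ₛ)
open import Data.List.Relation.Binary.Permutation.Propositional.Properties using (∈-resp-↭; ++-comm)
open import Data.List.Relation.Binary.Permutation.Setoid.Properties using (Unique-resp-↭)
open import Data.List.Relation.Binary.Pointwise using (Pointwise-≡⇒≡)
open import Data.List.Relation.Unary.Sorted.TotalOrder using (Sorted)
open import Data.List.Relation.Unary.Sorted.TotalOrder.Properties using (AllPairs⇒Sorted; Sorted⇒AllPairs; ↗↭↗⇒≋)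
open import Data.Product using (_,_; proj₁; ∃; ∃₂)
open import Data.Sum as Sum using (_⊎_; inj₁; inj₂)
open import Data.Empty using (⊥-elim)
open import Data.Unit using (tt)
open import Function using (_∘_; id)
open import Level using (0ℓ)
open import Relation.Nullary using (¬_; yes; no; map′; contradiction)
open import Relation.Binary.Definitions using (Asymmetric; DecidableEquality; Trichotomous; tri<; tri≈; tri>)
open import Relation.Binary.Structures using (IsStrictTotalOrder)
open import Relation.Binary.Bundles using (DecTotalOrder)
import Relation.Binary.Construct.StrictToNonStrict as StrictToNonStrict
open import Relation.Binary.PropositionalEquality
  using (_≡_; _≢_; refl; sym; trans; cong; cong₂; subst; subst₂; setoid; isEquivalence; resp₂)
open import Relation.Binary.Construct.Closure.ReflexiveTransitive using (ε; _◅_; _◅◅_)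

⪯-refl : ∀ {x} → x ⪯ x
⪯-refl {neg _} = ℕ.≤-refl
⪯-refl {pos _} = ℕ.≤-refl

⪯-trans : ∀ {x y z} → x ⪯ y → y ⪯ z → x ⪯ z
⪯-trans {neg _} {neg _} {neg _} p q = ℕ.≤-trans p q
⪯-trans {neg _} {neg _} {pos _} p q = ℕ.≤-trans p q
⪯-trans {neg _} {pos _} {neg _} p q = ℕ.≤-trans p (ℕ.<⇒≤ q)
⪯-trans {neg _} {pos _} {pos _} p q = ℕ.≤-trans p q
⪯-trans {pos _} {neg _} {neg _} p q = ℕ.<-≤-trans p q
⪯-trans {pos _} {neg _} {pos _} p q = ℕ.≤-trans (ℕ.<⇒≤ p) q
⪯-trans {pos _} {pos _} {neg _} p q = ℕ.≤-<-trans p q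
⪯-trans {pos _} {pos _} {pos _} p q = ℕ.≤-trans p q

⪯-antisym : ∀ {x y} → x ⪯ y → y ⪯ x → x ≡ y
⪯-antisym {neg _} {neg _} p q = cong neg (ℕ.≤-antisym p q)
⪯-antisym {neg _} {pos _} p q = ⊥-elim (ℕ.≤⇒≯ p q)
⪯-antisym {pos _} {neg _} p q = ⊥-elim (ℕ.≤⇒≯ q p)
⪯-antisym {pos _} {pos _} p q = cong pos (ℕ.≤-antisym p q)

⪯-total : ∀ x y → x ⪯ y ⊎ y ⪯ x
⪯-total (neg a) (neg b) = ℕ.≤-total a b
⪯-total (neg a) (pos b) = ≤-<-connex a b
⪯-total (pos a) (neg b) = <-≤-connex a b
⪯-total (pos a) (pos b) = ℕ.≤-total a b

_≟ᴾ_ : DecidableEquality P′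
neg a ≟ᴾ neg b = map′ (cong neg) (λ { refl → refl }) (a ℕ.≟ b)
neg a ≟ᴾ pos b = no λ ()
pos a ≟ᴾ neg b = no λ ()
pos a ≟ᴾ pos b = map′ (cong pos) (λ { refl → refl }) (a ℕ.≟ b)

module _ {n : ℕ} where

  private
    variable
      a b x : Fin n
      xs w : List (Fin n)

  lookup-Before : ∀ {R : Fin n → Fin n → Set} → AllPairs R w → Before w a b → R a b
  lookup-Before {a = a} {b} {R} rw (xs , ys , zs , refl) = go xs rw
    where
    go : ∀ xs → AllPairs R (xs ++ a ∷ ys ++ b ∷ zs) → R a b
    go []       (ra ∷ _) = All.head (++⁻ʳ ys ra)
    go (_ ∷ xs) (_ ∷ rw) = go xs rw

  tabulate-Before : ∀ {R : Fin n → Fin n → Set} w → (∀ a b → Before w a b → R a b) → AllPairs R w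
  tabulate-Before []       _ = []
  tabulate-Before (x ∷ xs) r =
    All.tabulate (λ y∈xs → let ys , zs , eq = ∈-∃++ y∈xs in r x _ ([] , ys , zs , cong (x ∷_) eq))
    ∷ tabulate-Before xs (λ a b (ps , qs , rs , eq) → r a b (x ∷ ps , qs , rs , cong (x ∷_) eq))

  Before-of-AllPairs : ∀ {R : Fin n → Fin n → Set} → Asymmetric R →
    AllPairs R w → a ∈ w → b ∈ w → R a b → Before w a b
  Before-of-AllPairs asym (_ ∷ _) (here refl) (here refl) raa = ⊥-elim (asym raa raa)
  Before-of-AllPairs {w = x ∷ _} asym (_ ∷ _) (here refl) (there b∈) _ =
    let ys , zs , eq = ∈-∃++ b∈ in [] , ys , zs , cong (x ∷_) eq
  Before-of-AllPairs asym (rx ∷ _) (there a∈) (here refl) rab = ⊥-elim (asym rab (All.lookup rx a∈))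
  Before-of-AllPairs {w = x ∷ _} asym (_ ∷ rw) (there a∈) (there b∈) rab =
    let ps , qs , rs , eq = Before-of-AllPairs asym rw a∈ b∈ rab in x ∷ ps , qs , rs , cong (x ∷_) eq

  Before-∷⇒∈ : Before (x ∷ xs) a b → b ∈ xs
  Before-∷⇒∈ ([]     , ys , _ , refl) = ∈-++⁺ʳ ys (here refl)
  Before-∷⇒∈ (_ ∷ ps , ys , _ , refl) = ∈-++⁺ʳ ps (there (∈-++⁺ʳ ys (here refl)))

  Before-∷⁻ : a ≢ x → Before (x ∷ xs) a b → Before xs a b
  Before-∷⁻ a≢x ([]     , _  , _  , refl) = ⊥-elim (a≢x refl)
  Before-∷⁻ _   (_ ∷ ps , ys , zs , refl) = ps , ys , zs , refl

  Before-++ʳ : ∀ us → Before xs a b → Before (xs ++ us) a b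
  Before-++ʳ {a = a} {b} us (ps , qs , rs , refl) =
    ps , qs , rs ++ us ,
    trans (++-assoc ps (a ∷ qs ++ b ∷ rs) us) (cong (λ zs → ps ++ a ∷ zs) (++-assoc qs (b ∷ rs) us))

  ∈⇒Before-∷ʳ : a ∈ xs → Before (xs ++ [ x ]) a x
  ∈⇒Before-∷ʳ {x = x} a∈xs with ∈-∃++ a∈xs
  ... | ys , zs , refl = ys , zs , [] , ++-assoc ys (_ ∷ zs) [ x ]

  IsPerm⇒Unique : IsPerm n w → Unique w
  IsPerm⇒Unique w↭ = Unique-resp-↭ (setoid (Fin n)) (↭⇒↭ₛ (↭-sym w↭)) (allFin⁺ n)

  Unique-rotate₁ : Unique (x ∷ xs) → Unique (xs ++ [ x ])
  Unique-rotate₁ {x} {xs} = Unique-resp-↭ (setoid (Fin n)) (↭⇒↭ₛ (++-comm [ x ] xs))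

++-≡-++ : ∀ {ℓ} {A : Set ℓ} (xs ys us vs : List A) → xs ++ ys ≡ us ++ vs →
  (∃ λ ms → us ≡ xs ++ ms × ys ≡ ms ++ vs) ⊎ (∃ λ ms → xs ≡ us ++ ms × vs ≡ ms ++ ys)
++-≡-++ []       ys us       vs eq = inj₁ (us , refl , eq)
++-≡-++ (x ∷ xs) ys []       vs eq = inj₂ (x ∷ xs , refl , sym eq)
++-≡-++ (x ∷ xs) ys (u ∷ us) vs eq with ∷-injective eq
... | refl , eq′ =
  Sum.map (λ (ms , p , q) → ms , cong (x ∷_) p , q) (λ (ms , p , q) → ms , cong (x ∷_) p , q)
          (++-≡-++ xs ys us vs eq′)

module _ {ℓ} {A : Set ℓ} where

  take-length-++ : ∀ (xs ys : List A) → take (length xs) (xs ++ ys) ≡ xs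
  take-length-++ []       ys = refl
  take-length-++ (x ∷ xs) ys = cong (x ∷_) (take-length-++ xs ys)

  drop-length-++ : ∀ (xs ys : List A) → drop (length xs) (xs ++ ys) ≡ ys
  drop-length-++ []       ys = refl
  drop-length-++ (x ∷ xs) ys = drop-length-++ xs ys

module _ {n : ℕ} where

  private
    variable
      u v w : List (Fin n)

  IsRotation⇒split : IsRotation w v → ∃₂ λ xs ys → w ≡ xs ++ ys × v ≡ ys ++ xs
  IsRotation⇒split {w} (k , refl) = take k w , drop k w , sym (take++drop≡id k w) , refl

  split⇒IsRotation : ∀ (xs ys : List (Fin n)) → IsRotation (xs ++ ys) (ys ++ xs)
  split⇒IsRotation xs ys = length xs , sym (cong₂ _++_ (drop-length-++ xs ys) (take-length-++ xs ys))

  IsRotation-refl : IsRotation w w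
  IsRotation-refl {w} = 0 , sym (++-identityʳ w)

  IsRotation-sym : IsRotation w v → IsRotation v w
  IsRotation-sym r with IsRotation⇒split r
  ... | xs , ys , refl , refl = split⇒IsRotation ys xs

  IsRotation-trans : IsRotation u v → IsRotation v w → IsRotation u w
  IsRotation-trans r r′ with IsRotation⇒split r | IsRotation⇒split r′
  ... | xs , ys , refl , eq | us , vs , eq′ , refl with ++-≡-++ ys xs us vs (trans (sym eq) eq′)
  ... | inj₁ (ms , refl , refl) =
    subst₂ (IsRotation {n}) (sym (++-assoc ms vs ys)) (++-assoc vs ys ms) (split⇒IsRotation ms (vs ++ ys))
  ... | inj₂ (ms , refl , refl) =
    subst₂ (IsRotation {n}) (++-assoc xs us ms) (sym (++-assoc ms xs us)) (split⇒IsRotation (xs ++ us) ms)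

  IsRotation-IsPerm : IsRotation w v → IsPerm n w → IsPerm n v
  IsRotation-IsPerm r w↭ with IsRotation⇒split r
  ... | xs , ys , refl , refl = ↭-trans (++-comm ys xs) w↭

-- Rotating a linear extension

module _ {n : ℕ} {D : Digraph n} where

  private
    variable
      a b x : Fin n
      xs : List (Fin n)

  head-IsSource : Unique (x ∷ xs) → LinExt (x ∷ xs) D → IsSource D x
  head-IsSource {x} (x∉xs ∷ _) lin j = ¬-not λ jx → All.lookup x∉xs (Before-∷⇒∈ (lin j x jx)) refl

  Arc-flipAt-source : IsSource D x → Arc (flipAt D x) a b → (b ≡ x × Arc D x a) ⊎ (a ≢ x × Arc D a b)
  Arc-flipAt-source {x} {a} {b} src with a Fin.≟ x | b Fin.≟ x
  ... | yes refl | _        = λ bx → contradiction (trans (sym bx) (src b)) λ ()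
  ... | no a≢x   | yes refl = λ xa → inj₁ (refl , xa)
  ... | no a≢x   | no _     = λ ab → inj₂ (a≢x , ab)

  LinExt-rotate₁ : Unique (x ∷ xs) → LinExt (x ∷ xs) D →
    FlipStep D (flipAt D x) × LinExt (xs ++ [ x ]) (flipAt D x)
  LinExt-rotate₁ {x} {xs} u lin = (x , inj₁ src , λ _ _ → refl) , lin′
    where
    src : IsSource D x
    src = head-IsSource u lin

    lin′ : LinExt (xs ++ [ x ]) (flipAt D x)
    lin′ a b ab with Arc-flipAt-source src ab
    ... | inj₁ (refl , xa)  = ∈⇒Before-∷ʳ (Before-∷⇒∈ (lin x a xa))
    ... | inj₂ (a≢x , ab′) = Before-++ʳ [ x ] (Before-∷⁻ a≢x (lin a b ab′))

LinExt-rotate : ∀ {n} (xs ys : List (Fin n)) {D : Digraph n} → Unique (xs ++ ys) → LinExt (xs ++ ys) D →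
  Σ (Digraph n) λ D′ → InToric D D′ × LinExt (ys ++ xs) D′
LinExt-rotate []       ys {D} _ lin = D , ε , subst (λ w → LinExt w D) (sym (++-identityʳ ys)) lin
LinExt-rotate (x ∷ xs) ys {D} u lin with LinExt-rotate₁ u lin
... | step , lin₁ with LinExt-rotate xs (ys ++ [ x ])
                         (subst Unique (++-assoc xs ys [ x ]) (Unique-rotate₁ u))
                         (subst (λ w → LinExt w (flipAt D x)) (++-assoc xs ys [ x ]) lin₁)
... | D′ , toric , lin′ = D′ , step ◅ toric , subst (λ w → LinExt w D′) (++-assoc ys [ x ] xs) lin′

-- The total order on [n] induced by f : [n] → P′

module InducedOrder {n : ℕ} (f : Fin n → P′) where

  private
    variable
      i j k : Fin n

  infix 4 _◁_
  _◁_ : Fin n → Fin n → Set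
  i ◁ j = (f i ⪯ f j)
        × (f i ≡ f j → IsPositive (f i) → i Fin.< j)
        × (f i ≡ f j → IsNegative (f i) → j Fin.< i)

  Tie : P′ → Fin n → Fin n → Set
  Tie (pos _) i j = i Fin.< j
  Tie (neg _) i j = j Fin.< i

  Tie-irrefl : ∀ t → ¬ Tie t i i
  Tie-irrefl (pos _) = Fin.<-irrefl refl
  Tie-irrefl (neg _) = Fin.<-irrefl refl

  Tie-trans : ∀ t → Tie t i j → Tie t j k → Tie t i k
  Tie-trans (pos _) ij jk = Fin.<-trans ij jk
  Tie-trans (neg _) ij jk = Fin.<-trans jk ij

  Tie-cmp : ∀ t i j → Tie t i j ⊎ i ≡ j ⊎ Tie t j i
  Tie-cmp t i j with Fin.<-cmp i j | t
  ... | tri< i<j _ _ | pos _ = inj₁ i<j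
  ... | tri< i<j _ _ | neg _ = inj₂ (inj₂ i<j)
  ... | tri≈ _ i≡j _ | _     = inj₂ (inj₁ i≡j)
  ... | tri> _ _ j<i | pos _ = inj₂ (inj₂ j<i)
  ... | tri> _ _ j<i | neg _ = inj₁ j<i

  untied⇒◁ : f i ≢ f j → f i ⪯ f j → i ◁ j
  untied⇒◁ fi≢fj fi⪯fj = fi⪯fj , (λ fi≡fj → ⊥-elim (fi≢fj fi≡fj)) , (λ fi≡fj → ⊥-elim (fi≢fj fi≡fj))

  Tie⇒◁ : f i ≡ f j → Tie (f i) i j → i ◁ j
  Tie⇒◁ {i} {j} fi≡fj t = subst (f i ⪯_) fi≡fj ⪯-refl , (λ _ → positive (f i) t) , (λ _ → negative (f i) t)
    where
    positive : ∀ s → Tie s i j → IsPositive s → i Fin.< j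
    positive (pos _) t _ = t
    negative : ∀ s → Tie s i j → IsNegative s → j Fin.< i
    negative (neg _) t _ = t

  ◁⇒Tie : i ◁ j → f i ≡ f j → Tie (f i) i j
  ◁⇒Tie {i} {j} (_ , pos⇒ , neg⇒) fi≡fj = bySign (f i) (pos⇒ fi≡fj) (neg⇒ fi≡fj)
    where
    bySign : ∀ s → (IsPositive s → i Fin.< j) → (IsNegative s → j Fin.< i) → Tie s i j
    bySign (pos _) p _ = p tt
    bySign (neg _) _ q = q tt

  ◁-irrefl : ¬ i ◁ i
  ◁-irrefl {i} ii = Tie-irrefl (f i) (◁⇒Tie ii refl)

  ◁-trans : i ◁ j → j ◁ k → i ◁ k
  ◁-trans {i} {j} {k} ij jk with f i ≟ᴾ f k
  ... | no fi≢fk  = untied⇒◁ fi≢fk (⪯-trans (proj₁ ij) (proj₁ jk))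
  ... | yes fi≡fk =
    Tie⇒◁ fi≡fk (Tie-trans (f i) (◁⇒Tie ij fi≡fj) (subst (λ t → Tie t j k) (sym fi≡fj) (◁⇒Tie jk fj≡fk)))
    where
    fi≡fj : f i ≡ f j
    fi≡fj = ⪯-antisym (proj₁ ij) (subst (f j ⪯_) (sym fi≡fk) (proj₁ jk))
    fj≡fk : f j ≡ f k
    fj≡fk = trans (sym fi≡fj) fi≡fk

  ◁-asym : Asymmetric _◁_
  ◁-asym ij ji = ◁-irrefl (◁-trans ij ji)

  ◁-cmp : ∀ i j → i ◁ j ⊎ i ≡ j ⊎ j ◁ i
  ◁-cmp i j with f i ≟ᴾ f j
  ... | no fi≢fj  = Sum.map (untied⇒◁ fi≢fj) (inj₂ ∘ untied⇒◁ (fi≢fj ∘ sym)) (⪯-total (f i) (f j))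
  ... | yes fi≡fj = Sum.map (Tie⇒◁ fi≡fj) (Sum.map id (Tie⇒◁ (sym fi≡fj) ∘ subst (λ t → Tie t j i) fi≡fj))
                            (Tie-cmp (f i) i j)

  ◁-compare : Trichotomous _≡_ _◁_
  ◁-compare i j with ◁-cmp i j
  ... | inj₁ ij          = tri< ij (λ { refl → ◁-irrefl ij }) (◁-asym ij)
  ... | inj₂ (inj₁ refl) = tri≈ ◁-irrefl refl ◁-irrefl
  ... | inj₂ (inj₂ ji)   = tri> (λ ij → ◁-asym ij ji) (λ { refl → ◁-irrefl ji }) ji

  ◁-isStrictTotalOrder : IsStrictTotalOrder _≡_ _◁_
  ◁-isStrictTotalOrder = record
    { isStrictPartialOrder = record
      { isEquivalence = isEquivalence
      ; irrefl        = λ { refl → ◁-irrefl }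
      ; trans         = ◁-trans
      ; <-resp-≈      = resp₂ _◁_
      }
    ; compare = ◁-compare
    }

  ⊴-decTotalOrder : DecTotalOrder 0ℓ 0ℓ 0ℓ
  ⊴-decTotalOrder = record
    { isDecTotalOrder = StrictToNonStrict.isDecTotalOrder _≡_ _◁_ ◁-isStrictTotalOrder }

  open DecTotalOrder ⊴-decTotalOrder using (totalOrder)
  open import Data.List.Sort ⊴-decTotalOrder using (sort; sort-↭; sort-↗)

  sortedWord : List (Fin n)
  sortedWord = sort (allFin n)

  sortedWord-IsPerm : IsPerm n sortedWord
  sortedWord-IsPerm = sort-↭ (allFin n)

  sortedWord-◁ : AllPairs _◁_ sortedWord
  sortedWord-◁ =
    AllPairs.zipWith strict (Sorted⇒AllPairs totalOrder (sort-↗ (allFin n)) , IsPerm⇒Unique sortedWord-IsPerm)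
    where
    strict : ∀ {i j} → (i ◁ j ⊎ i ≡ j) × i ≢ j → i ◁ j
    strict (inj₁ ij , _)    = ij
    strict (inj₂ i≡j , i≢j) = ⊥-elim (i≢j i≡j)

  sortedWord-EnrichedW : EnrichedW sortedWord f
  sortedWord-EnrichedW _ _ = lookup-Before sortedWord-◁

  sortedWord-LinExt : ∀ {D} → Enriched D f → LinExt sortedWord D
  sortedWord-LinExt enr a b ab =
    Before-of-AllPairs ◁-asym sortedWord-◁ (∈-sorted a) (∈-sorted b) (enr a b ab)
    where
    ∈-sorted : ∀ i → i ∈ sortedWord
    ∈-sorted i = ∈-resp-↭ (↭-sym sortedWord-IsPerm) (∈-allFin i)

  EnrichedW-unique : ∀ {u v} → IsPerm n u → IsPerm n v → EnrichedW u f → EnrichedW v f → u ≡ v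
  EnrichedW-unique {u} {v} u↭ v↭ enr-u enr-v =
    Pointwise-≡⇒≡ (↗↭↗⇒≋ totalOrder (sorted u enr-u) (sorted v enr-v) (↭⇒↭ₛ (↭-trans u↭ (↭-sym v↭))))
    where
    sorted : ∀ w → EnrichedW w f → Sorted totalOrder w
    sorted w enr = AllPairs⇒Sorted totalOrder (AllPairs.map inj₁ (tabulate-Before w enr))

module _ {n : ℕ} {f : Fin n → P′} where

  open InducedOrder f

  EnrichedTor⇒TorExt : ∀ {D} → EnrichedTor D f →
    Σ (List (Fin n)) (λ w → IsPerm n w × TorExt w D × EnrichedTorW w f)
  EnrichedTor⇒TorExt (D′ , toric , enr) =
    sortedWord , sortedWord-IsPerm ,
    (sortedWord , D′ , IsRotation-refl , toric , sortedWord-LinExt enr) ,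
    (sortedWord , IsRotation-refl , sortedWord-EnrichedW)

  TorExt⇒EnrichedTor : ∀ {D w} → IsPerm n w → TorExt w D → EnrichedTorW w f → EnrichedTor D f
  TorExt⇒EnrichedTor w↭ (v , D′ , w~v , toric , lin) (u , w~u , enr)
    with IsRotation⇒split (IsRotation-trans (IsRotation-sym w~v) w~u)
  ... | xs , ys , refl , refl with LinExt-rotate xs ys (IsPerm⇒Unique (IsRotation-IsPerm w~v w↭)) lin
  ... | D″ , toric′ , lin′ = D″ , toric ◅◅ toric′ , λ a b ab → enr a b (lin′ a b ab)

  EnrichedTorW⇒IsRotation : ∀ {w w′} → IsPerm n w → IsPerm n w′ →
    EnrichedTorW w f → EnrichedTorW w′ f → IsRotation w w′
  EnrichedTorW⇒IsRotation w↭ w′↭ (u , w~u , enr) (u′ , w′~u′ , enr′)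
    with EnrichedW-unique (IsRotation-IsPerm w~u w↭) (IsRotation-IsPerm w′~u′ w′↭) enr enr′
  ... | refl = IsRotation-trans w~u (IsRotation-sym w′~u′)

mainTheorem2 : (n : ℕ) (D : Digraph n) → Acyclic D →
    -- union: f ∈ 𝓔^tor([D]) iff f ∈ 𝓔^tor([w]) for some [w] ∈ 𝓛^tor([D])
    ((f : Fin n → P′) →
      EnrichedTor D f ⇔
        Σ (List (Fin n)) (λ w → IsPerm n w × TorExt w D × EnrichedTorW w f))
    -- disjointness: distinct cyclic permutations in 𝓛^tor([D]) give disjoint sets
    × ((w w′ : List (Fin n)) (f : Fin n → P′) →
        IsPerm n w → IsPerm n w′ → TorExt w D → TorExt w′ D →
        EnrichedTorW w f → EnrichedTorW w′ f → IsRotation w w′)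
mainTheorem2 n D _ =
  (λ f → mk⇔ EnrichedTor⇒TorExt (λ (w , w↭ , ext , enr) → TorExt⇒EnrichedTor w↭ ext enr)) ,
  λ w w′ f w↭ w′↭ _ _ → EnrichedTorW⇒IsRotation w↭ w′↭
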